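{- Let $n$ be a positive integer and $\delta(n)=\min\{r+s\mid r,s\in\mathbb N_0,\ r\le s,\ rs=n\}$. Then: (i) $\delta(n)<\frac{n+12}{4}$ if and only if both of the following hold: (a) $n\ne p,2p,3p,4p$ for every odd prime $p$; (b) $n\notin\{4,6,8,16,18,24,25,27,30,32,35,36,40\}$. (ii) $\delta(n)=\frac{n+12}{4}$ if and only if $n\in\{4,36,40\}$.
   Context: $\mathbb N_0$ denotes the set of non-negative integers. -}

module Defs where

open import Data.Nat using (ℕ; _+_; _*_; _≤_)
open import Data.Nat.Primality using (Prime)
open import Data.Nat.DivMod using (_%_)
open import Data.Product using (Σ; ∃; _×_)
open import Relation.Binary.PropositionalEquality using (_≡_)

IsDelta : ℕ → ℕ → Set
IsDelta n d =
  (∃ λ r → ∃ λ s → r ≤ s × r * s ≡ n × r + s ≡ d) ×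
  (∀ r s → r ≤ s → r * s ≡ n → d ≤ r + s)

IsMulOddPrime : ℕ → ℕ → Set
IsMulOddPrime k n = ∃ λ p → Prime p × p % 2 ≡ 1 × n ≡ k * p

-- Writing r = 4 + a and s = 4 + b, the identity 4 (r + s) + a b = r s + 16 shows that
-- 4 (r + s) < r s + 12 exactly when a b > 4, and 4 (r + s) = r s + 12 exactly when a b = 4;
-- pairs with r ≤ 4 ≤ s always give 4 (r + s) ≥ r s + 16.  So 4 δ(n) < n + 12 means that
-- n = (4 + a)(4 + b) with a b > 4 (or n ≤ 2).  Such n are at least 41, as 4 a b ≤ (a + b)²
-- forces a + b ≥ 5, and they are not k p with k ≤ 4 and p prime, since p divides one of the factors and the other one then divides k.
-- Conversely, let k be the largest divisor of n among 1, …, 4 and n = m k.  If m is prime,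
-- n = k p; if m = u v is composite, maximality forces k u, k v ≥ 5, so (k u) v or (k v) u
-- has both factors at least 5 unless u, v ≤ 4, which leaves finitely many n.  A factor
-- pair with both factors at least 5 and a b ≤ 4 gives n ∈ {25, 30, 35, 36, 40}.
module Submission where

open import Defs
open import Data.Nat using (ℕ; _+_; _*_; _≤_; _<_)
open import Data.List using (List; _∷_; [])
open import Data.List.Membership.Propositional using (_∈_; _∉_)
open import Data.Product using (_×_)
open import Function.Bundles using (_⇔_)
open import Relation.Nullary using (¬_)
open import Relation.Binary.PropositionalEquality using (_≡_)

open import Data.Nat using (suc; z≤n; s≤s; z<s; _≟_; _≤?_; _<?_; >-nonZero; n>1⇒nonTrivial; nonTrivial⇒n>1)
open import Data.Nat.Properties
open import Data.Nat.DivMod using (_%_; m%n<n)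
open import Data.Nat.Divisibility using (_∣_; divides; _∣?_; ∣⇒≤; m%n≡0⇒n∣m)
open import Data.Nat.Divisibility.Core using (hasNonTrivialDivisor)
open import Data.Nat.Primality using (Prime; Composite; composite; prime?; euclidsLemma; ¬prime[0]; ¬prime[1]; prime⇒nonZero; prime⇒¬composite; ¬prime⇒composite)
open import Data.Nat.Tactic.RingSolver using (solve-∀)
open import Data.List.Relation.Unary.All as All using (All; all?)
open import Data.List.Relation.Unary.Any using (here; there)
open import Data.List.Membership.DecPropositional _≟_ using (_∈?_)
open import Data.Product using (∃; ∃₂; _,_; proj₁; proj₂; uncurry)
open import Data.Product.Function.NonDependent.Propositional using (_×-⇔_)
open import Data.Sum using (_⊎_; inj₁; inj₂; [_,_]′)
open import Data.Empty using (⊥-elim)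
open import Function using (_∘_; id)
open import Function.Bundles using (mk⇔; Equivalence)
open import Function.Properties.Equivalence using () renaming (refl to ⇔-refl; trans to ⇔-trans)
open import Relation.Nullary using (Dec; yes; no; contradiction)
open import Relation.Nullary.Decidable using (from-yes; _×-dec_; _⊎-dec_; _→-dec_)
open import Relation.Binary.PropositionalEquality using (refl; sym; trans; cong; cong₂; subst; subst₂; _≢_)

private
  variable
    d n p r s x y : ℕ

exceptions : List ℕ
exceptions = 4 ∷ 6 ∷ 8 ∷ 16 ∷ 18 ∷ 24 ∷ 25 ∷ 27 ∷ 30 ∷ 32 ∷ 35 ∷ 36 ∷ 40 ∷ []

Subcritical : ℕ → Set
Subcritical n = ∃₂ λ r s → r ≤ s × r * s ≡ n × 4 * (r + s) < n + 12

Critical : ℕ → Set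
Critical n = ∃₂ λ r s → r ≤ s × r * s ≡ n × 4 * (r + s) ≡ n + 12

SmallMultipleOfOddPrime : ℕ → Set
SmallMultipleOfOddPrime n = ∃ λ k → 1 ≤ k × k ≤ 4 × IsMulOddPrime k n

LargeFactorPair : ℕ → Set
LargeFactorPair n = ∃₂ λ x y → 5 ≤ x × 5 ≤ y × x * y ≡ n

isDelta⇒<⇔subcritical : IsDelta n d → 4 * d < n + 12 ⇔ Subcritical n
isDelta⇒<⇔subcritical {n} ((r , s , r≤s , rs≡n , r+s≡d) , minimal) = mk⇔
  (λ 4d< → r , s , r≤s , rs≡n , subst (λ t → 4 * t < n + 12) (sym r+s≡d) 4d<)
  (λ (r′ , s′ , r′≤s′ , r′s′≡n , lt) → ≤-<-trans (*-monoʳ-≤ 4 (minimal r′ s′ r′≤s′ r′s′≡n)) lt)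

isDelta⇒≡⇔critical : IsDelta n d → 4 * d ≡ n + 12 ⇔ (Critical n × ¬ Subcritical n)
isDelta⇒≡⇔critical {n} {d} isδ@((r , s , r≤s , rs≡n , r+s≡d) , minimal) = mk⇔
  (λ 4d≡ → (r , s , r≤s , rs≡n , subst (λ t → 4 * t ≡ n + 12) (sym r+s≡d) 4d≡)
         , λ sub → <-irrefl 4d≡ (Equivalence.from below sub))
  (λ ((r′ , s′ , r′≤s′ , r′s′≡n , eq) , ¬sub) →
    ≤-antisym (≤-trans (*-monoʳ-≤ 4 (minimal r′ s′ r′≤s′ r′s′≡n)) (≤-reflexive eq))
              (≮⇒≥ (¬sub ∘ Equivalence.to below)))
  where
  below : 4 * d < n + 12 ⇔ Subcritical n
  below = isDelta⇒<⇔subcritical isδ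

m+n≡o+k⇒m<o⇔k<n : ∀ {m n o k} → m + n ≡ o + k → m < o ⇔ k < n
m+n≡o+k⇒m<o⇔k<n {m} {n} {o} {k} eq = mk⇔
  (λ m<o → +-cancelˡ-< o k n (subst (_< o + n) eq (+-monoˡ-< n m<o)))
  (λ k<n → +-cancelʳ-< n m o (subst (_< o + n) (sym eq) (+-monoʳ-< o k<n)))

m+n≡o+k⇒m≡o⇒n≡k : ∀ {m n o k} → m + n ≡ o + k → m ≡ o → n ≡ k
m+n≡o+k⇒m≡o⇒n≡k {o = o} eq refl = +-cancelˡ-≡ o _ _ eq

shift-identity : ∀ a b → 4 * ((4 + a) + (4 + b)) + a * b ≡ ((4 + a) * (4 + b) + 12) + 4
shift-identity = solve-∀

shifted-subcritical⇔ : ∀ a b → 4 * ((4 + a) + (4 + b)) < (4 + a) * (4 + b) + 12 ⇔ 4 < a * b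
shifted-subcritical⇔ a b = m+n≡o+k⇒m<o⇔k<n (shift-identity a b)

shifted-critical⇒ : ∀ a b → 4 * ((4 + a) + (4 + b)) ≡ (4 + a) * (4 + b) + 12 → a * b ≡ 4
shifted-critical⇒ a b = m+n≡o+k⇒m≡o⇒n≡k (shift-identity a b)

lopsided-bound : r ≤ 4 → 4 ≤ s → r * s + 12 < 4 * (r + s)
lopsided-bound {r} r≤4 4≤s with c , r+c≡4 ← m≤n⇒∃[o]m+o≡n r≤4 | b , refl ← m≤n⇒∃[o]m+o≡n 4≤s =
  <-≤-trans (+-monoʳ-< (r * (4 + b)) (m<m+n 12 z<s)) (≤-trans (m≤m+n _ (c * b)) (≤-reflexive balanced))
  where
  identity : ∀ r c b → r * (4 + b) + 16 + c * b + 4 * b ≡ 4 * (r + (4 + b)) + (r + c) * b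
  identity = solve-∀
  balanced : r * (4 + b) + 16 + c * b ≡ 4 * (r + (4 + b))
  balanced = +-cancelʳ-≡ (4 * b) _ _ (trans (identity r c b) (cong (λ t → 4 * (r + (4 + b)) + t * b) r+c≡4))

data FactorPair : ℕ → ℕ → Set where
  short    : s < 4 → FactorPair r s
  lopsided : r ≤ 4 → 4 ≤ s → FactorPair r s
  large    : ∀ a b → 1 ≤ a → 1 ≤ b → FactorPair (4 + a) (4 + b)

factorPair : r ≤ s → FactorPair r s
factorPair {r} {s} r≤s with s <? 4 | r ≤? 4
... | yes s<4 | _       = short s<4
... | no s≮4  | yes r≤4 = lopsided r≤4 (≮⇒≥ s≮4)
... | no _    | no r≰4  = both-large (≰⇒> r≰4) (≤-trans (≰⇒> r≰4) r≤s)
  where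
  both-large : 5 ≤ r → 5 ≤ s → FactorPair r s
  both-large (s≤s (s≤s (s≤s (s≤s 1≤a)))) (s≤s (s≤s (s≤s (s≤s 1≤b)))) = large _ _ 1≤a 1≤b

m*n≤o⇒m≤o : ∀ {m n o} → 1 ≤ n → m * n ≤ o → m ≤ o
m*n≤o⇒m≤o {m} {n} 1≤n = ≤-trans (m≤m*n m n {{>-nonZero 1≤n}})

m*n≤o⇒n≤o : ∀ {m n o} → 1 ≤ m → m * n ≤ o → n ≤ o
m*n≤o⇒n≤o {m} {n} 1≤m = ≤-trans (m≤n*m n m {{>-nonZero 1≤m}})

4*[m*n]≤[m+n]*[m+n] : ∀ m n → 4 * (m * n) ≤ (m + n) * (m + n)
4*[m*n]≤[m+n]*[m+n] m n = [ ordered , swapped ]′ (≤-total m n)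
  where
  square-gap : ∀ m c → (m + (m + c)) * (m + (m + c)) ≡ 4 * (m * (m + c)) + c * c
  square-gap = solve-∀
  ordered : ∀ {m n} → m ≤ n → 4 * (m * n) ≤ (m + n) * (m + n)
  ordered {m} m≤n with c , refl ← m≤n⇒∃[o]m+o≡n m≤n =
    subst (4 * (m * (m + c)) ≤_) (sym (square-gap m c)) (m≤m+n _ (c * c))
  swapped : n ≤ m → 4 * (m * n) ≤ (m + n) * (m + n)
  swapped n≤m = subst₂ _≤_ (cong (4 *_) (*-comm n m)) (cong₂ _*_ (+-comm n m) (+-comm n m)) (ordered n≤m)

4<m*n⇒4<m+n : ∀ m n → 4 < m * n → 4 < m + n
4<m*n⇒4<m+n m n 4<mn = ≰⇒> λ m+n≤4 →
  <⇒≱ 4<mn (*-cancelˡ-≤ 4 (≤-trans (4*[m*n]≤[m+n]*[m+n] m n) (*-mono-≤ m+n≤4 m+n≤4)))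

4<a*b⇒41≤[4+a]*[4+b] : ∀ a b → 4 < a * b → 41 ≤ (4 + a) * (4 + b)
4<a*b⇒41≤[4+a]*[4+b] a b 4<ab = begin
  16 + 4 * 5 + 5             ≤⟨ +-mono-≤ (+-monoʳ-≤ 16 (*-monoʳ-≤ 4 (4<m*n⇒4<m+n a b 4<ab))) 4<ab ⟩
  16 + 4 * (a + b) + a * b   ≡⟨ expand a b ⟩
  (4 + a) * (4 + b)          ∎
  where
  open ≤-Reasoning
  expand : ∀ a b → 16 + 4 * (a + b) + a * b ≡ (4 + a) * (4 + b)
  expand = solve-∀

short-subcritical : ∀ {r} → r < 4 → ∀ {s} → s < 4 → r ≤ s → 4 * (r + s) < r * s + 12 → r * s ≤ 2
short-subcritical = from-yes (allUpTo? (λ r → allUpTo? (λ s →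
  (r ≤? s) →-dec ((4 * (r + s) <? r * s + 12) →-dec (r * s ≤? 2))) 4) 4)

short-critical : ∀ {r} → r < 4 → ∀ {s} → s < 4 → 0 < r * s → 4 * (r + s) ≡ r * s + 12 →
  r * s ∈ (4 ∷ 36 ∷ 40 ∷ [])
short-critical = from-yes (allUpTo? (λ r → allUpTo? (λ s →
  (0 <? r * s) →-dec ((4 * (r + s) ≟ r * s + 12) →-dec (r * s ∈? (4 ∷ 36 ∷ 40 ∷ [])))) 4) 4)

shifted-critical : ∀ {a} → a < 5 → ∀ {b} → b < 5 → a * b ≡ 4 → (4 + a) * (4 + b) ∈ (4 ∷ 36 ∷ 40 ∷ [])
shifted-critical = from-yes (allUpTo? (λ a → allUpTo? (λ b →
  (a * b ≟ 4) →-dec ((4 + a) * (4 + b) ∈? (4 ∷ 36 ∷ 40 ∷ []))) 5) 5)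

shifted-exceptional : ∀ {a} → a < 5 → ∀ {b} → b < 5 → 1 ≤ a → 1 ≤ b → a * b ≤ 4 →
  (4 + a) * (4 + b) ∈ exceptions
shifted-exceptional = from-yes (allUpTo? (λ a → allUpTo? (λ b →
  (1 ≤? a) →-dec ((1 ≤? b) →-dec ((a * b ≤? 4) →-dec ((4 + a) * (4 + b) ∈? exceptions)))) 5) 5)

exceptions-between : All (λ m → 4 ≤ m × m ≤ 40) exceptions
exceptions-between = from-yes (all? (λ m → (4 ≤? m) ×-dec (m ≤? 40)) exceptions)

outside⇒∉exceptions : n < 4 ⊎ 40 < n → n ∉ exceptions
outside⇒∉exceptions out n∈ with All.lookup exceptions-between n∈ | out
... | 4≤n , _    | inj₁ n<4  = <⇒≱ n<4 4≤n
... | _ , n≤40   | inj₂ 40<n = <⇒≱ 40<n n≤40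

odd-prime⇒3≤ : Prime p → p % 2 ≡ 1 → 3 ≤ p
odd-prime⇒3≤ {0} pr _ = contradiction pr ¬prime[0]
odd-prime⇒3≤ {1} pr _ = contradiction pr ¬prime[1]
odd-prime⇒3≤ {2} _ ()
odd-prime⇒3≤ {suc (suc (suc _))} _ _ = s≤s (s≤s (s≤s z≤n))

prime∧3≤⇒odd : Prime p → 3 ≤ p → p % 2 ≡ 1
prime∧3≤⇒odd {p} pr 3≤p with p % 2 in eq | m%n<n p 2
... | 0           | _ = contradiction (composite 3≤p (m%n≡0⇒n∣m p 2 eq)) (prime⇒¬composite pr)
... | 1           | _ = refl
... | suc (suc _) | s≤s (s≤s ())

prime∣x∧x*y≡k*p⇒y≤k : ∀ {k} → Prime p → 1 ≤ k → p ∣ x → x * y ≡ k * p → y ≤ k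
prime∣x∧x*y≡k*p⇒y≤k {p = p} {y = y} {k = k} pr 1≤k (divides t refl) eq =
  ∣⇒≤ {{>-nonZero 1≤k}} (divides t (sym (*-cancelʳ-≡ (t * y) k p {{prime⇒nonZero pr}} (trans (swap t p y) eq))))
  where
  swap : ∀ t p y → t * y * p ≡ t * p * y
  swap = solve-∀

x*y≡k*p⇒x≤k⊎y≤k : ∀ {k} → Prime p → 1 ≤ k → x * y ≡ k * p → x ≤ k ⊎ y ≤ k
x*y≡k*p⇒x≤k⊎y≤k {x = x} {y = y} {k = k} pr 1≤k eq with euclidsLemma x y pr (divides k eq)
... | inj₁ p∣x = inj₂ (prime∣x∧x*y≡k*p⇒y≤k pr 1≤k p∣x eq)
... | inj₂ p∣y = inj₁ (prime∣x∧x*y≡k*p⇒y≤k pr 1≤k p∣y (trans (*-comm y x) eq))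

n≤2⇒¬smallMultiple : n ≤ 2 → ¬ SmallMultipleOfOddPrime n
n≤2⇒¬smallMultiple n≤2 (k , 1≤k , _ , p , pr , odd , refl) =
  <⇒≱ (≤-trans (odd-prime⇒3≤ pr odd) (m≤n*m p k {{>-nonZero 1≤k}})) n≤2

largeFactorPair⇒¬smallMultiple : LargeFactorPair n → ¬ SmallMultipleOfOddPrime n
largeFactorPair⇒¬smallMultiple (x , y , 5≤x , 5≤y , refl) (k , 1≤k , k≤4 , p , pr , _ , xy≡kp)
  with x*y≡k*p⇒x≤k⊎y≤k pr 1≤k xy≡kp
... | inj₁ x≤k = <⇒≱ 5≤x (≤-trans x≤k k≤4)
... | inj₂ y≤k = <⇒≱ 5≤y (≤-trans y≤k k≤4)

¬smallMultiple⇔ : (¬ SmallMultipleOfOddPrime n) ⇔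
  (¬ IsMulOddPrime 1 n × ¬ IsMulOddPrime 2 n × ¬ IsMulOddPrime 3 n × ¬ IsMulOddPrime 4 n)
¬smallMultiple⇔ = mk⇔
  (λ ¬sm → (λ kp → ¬sm (1 , ≤-refl , s≤s z≤n , kp)) , (λ kp → ¬sm (2 , s≤s z≤n , s≤s (s≤s z≤n) , kp))
         , (λ kp → ¬sm (3 , s≤s z≤n , s≤s (s≤s (s≤s z≤n)) , kp)) , (λ kp → ¬sm (4 , s≤s z≤n , ≤-refl , kp)))
  λ where (¬1 , ¬2 , ¬3 , ¬4) (1 , _ , _ , kp) → ¬1 kp
          (¬1 , ¬2 , ¬3 , ¬4) (2 , _ , _ , kp) → ¬2 kp
          (¬1 , ¬2 , ¬3 , ¬4) (3 , _ , _ , kp) → ¬3 kp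
          (¬1 , ¬2 , ¬3 , ¬4) (4 , _ , _ , kp) → ¬4 kp
          _ (suc (suc (suc (suc (suc _)))) , _ , s≤s (s≤s (s≤s (s≤s ()))) , _)

composite⇒product : Composite n → ∃₂ λ u v → 2 ≤ u × 2 ≤ v × n ≡ u * v
composite⇒product (hasNonTrivialDivisor u<n (divides 0 refl)) = contradiction u<n n≮0
composite⇒product (hasNonTrivialDivisor {u} u<n (divides 1 refl)) = contradiction u<n (<-irrefl (sym (+-identityʳ u)))
composite⇒product (hasNonTrivialDivisor {u} {{nt}} _ (divides (suc (suc v)) refl)) =
  u , 2 + v , nonTrivial⇒n>1 u {{nt}} , s≤s (s≤s z≤n) , *-comm (2 + v) u

record LargestSmallDivisor (n : ℕ) : Set where
  field
    k       : ℕ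
    m       : ℕ
    1≤k     : 1 ≤ k
    k≤4     : k ≤ 4
    n≡m*k   : n ≡ m * k
    maximal : ∀ {j} → j ≤ 4 → j ∣ n → j ≤ k

≤∧≢⇒≤pred : ∀ {j k} → j ≤ suc k → j ≢ suc k → j ≤ k
≤∧≢⇒≤pred j≤ j≢ = ≤-pred (≤∧≢⇒< j≤ j≢)

∣∧∤⇒≢ : ∀ {i j} → j ∣ n → ¬ i ∣ n → j ≢ i
∣∧∤⇒≢ {n} j∣n i∤n j≡i = i∤n (subst (_∣ n) j≡i j∣n)

largestSmallDivisor : ∀ n → LargestSmallDivisor n
largestSmallDivisor n with 4 ∣? n | 3 ∣? n | 2 ∣? n
... | yes (divides q eq) | _ | _ = record
  { k = 4 ; m = q ; 1≤k = s≤s z≤n ; k≤4 = ≤-refl ; n≡m*k = eq ; maximal = λ j≤4 _ → j≤4 }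
... | no 4∤n | yes (divides q eq) | _ = record
  { k = 3 ; m = q ; 1≤k = s≤s z≤n ; k≤4 = n≤1+n 3 ; n≡m*k = eq
  ; maximal = λ j≤4 j∣n → ≤∧≢⇒≤pred j≤4 (∣∧∤⇒≢ j∣n 4∤n) }
... | no 4∤n | no 3∤n | yes (divides q eq) = record
  { k = 2 ; m = q ; 1≤k = s≤s z≤n ; k≤4 = ≤-trans (n≤1+n 2) (n≤1+n 3) ; n≡m*k = eq
  ; maximal = λ j≤4 j∣n → ≤∧≢⇒≤pred (≤∧≢⇒≤pred j≤4 (∣∧∤⇒≢ j∣n 4∤n)) (∣∧∤⇒≢ j∣n 3∤n) }
... | no 4∤n | no 3∤n | no 2∤n = record
  { k = 1 ; m = n ; 1≤k = ≤-refl ; k≤4 = s≤s z≤n ; n≡m*k = sym (*-identityʳ n)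
  ; maximal = λ j≤4 j∣n →
      ≤∧≢⇒≤pred (≤∧≢⇒≤pred (≤∧≢⇒≤pred j≤4 (∣∧∤⇒≢ j∣n 4∤n)) (∣∧∤⇒≢ j∣n 3∤n)) (∣∧∤⇒≢ j∣n 2∤n) }

-- The middle alternative occurs for k = 4, where n = (2 u)(2 v).
small-cofactors : ∀ {k} → k < 5 → ∀ {u} → u < 5 → ∀ {v} → v < 5 →
  2 ≤ u → 2 ≤ v → 5 ≤ k * u → 5 ≤ k * v →
  u * v * k ∈ exceptions ⊎ (5 ≤ 2 * u × 5 ≤ 2 * v × u * v * k ≡ 2 * u * (2 * v)) ⊎ (k < 4 × 4 ∣ u * v * k)
small-cofactors = from-yes (allUpTo? (λ k → allUpTo? (λ u → allUpTo? (λ v →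
  (2 ≤? u) →-dec ((2 ≤? v) →-dec ((5 ≤? k * u) →-dec ((5 ≤? k * v) →-dec
  ((u * v * k ∈? exceptions)
   ⊎-dec (((5 ≤? 2 * u) ×-dec ((5 ≤? 2 * v) ×-dec (u * v * k ≟ 2 * u * (2 * v))))
   ⊎-dec ((k <? 4) ×-dec (4 ∣? u * v * k)))))))) 5) 5) 5)

module _ {n : ℕ} (lsd : LargestSmallDivisor n) where
  open LargestSmallDivisor lsd

  divisor*factor≥5 : ∀ {u w} → 2 ≤ u → k * u * w ≡ n → 5 ≤ k * u
  divisor*factor≥5 {u} {w} 2≤u kuw≡n = ≰⇒> λ ku≤4 →
    <⇒≱ (m<m*n k u {{>-nonZero 1≤k}} 2≤u) (maximal ku≤4 (divides w (trans (sym kuw≡n) (*-comm (k * u) w))))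

  composite-cofactor : ∀ {u v} → 2 ≤ u → 2 ≤ v → m ≡ u * v → LargeFactorPair n ⊎ n ∈ exceptions
  composite-cofactor {u} {v} 2≤u 2≤v m≡uv = split (5 ≤? u) (5 ≤? v)
    where
    n≡uvk : n ≡ u * v * k
    n≡uvk = trans n≡m*k (cong (_* k) m≡uv)
    move-k : ∀ u v k → u * v * k ≡ k * u * v
    move-k = solve-∀
    kuv≡n : k * u * v ≡ n
    kuv≡n = sym (trans n≡uvk (move-k u v k))
    kvu≡n : k * v * u ≡ n
    kvu≡n = sym (trans n≡uvk (trans (cong (_* k) (*-comm u v)) (move-k v u k)))
    split : Dec (5 ≤ u) → Dec (5 ≤ v) → LargeFactorPair n ⊎ n ∈ exceptions
    split _ (yes 5≤v) = inj₁ (k * u , v , divisor*factor≥5 2≤u kuv≡n , 5≤v , kuv≡n)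
    split (yes 5≤u) (no _) = inj₁ (k * v , u , divisor*factor≥5 2≤v kvu≡n , 5≤u , kvu≡n)
    split (no 5≰u) (no 5≰v) with small-cofactors (s≤s k≤4) (≰⇒> 5≰u) (≰⇒> 5≰v) 2≤u 2≤v
                                   (divisor*factor≥5 2≤u kuv≡n) (divisor*factor≥5 2≤v kvu≡n)
    ... | inj₁ uvk∈ = inj₂ (subst (_∈ exceptions) (sym n≡uvk) uvk∈)
    ... | inj₂ (inj₁ (5≤2u , 5≤2v , eq)) = inj₁ (2 * u , 2 * v , 5≤2u , 5≤2v , sym (trans n≡uvk eq))
    ... | inj₂ (inj₂ (k<4 , 4∣uvk)) =
      contradiction (maximal ≤-refl (subst (4 ∣_) (sym n≡uvk) 4∣uvk)) (<⇒≱ k<4)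

  9≤n⇒3≤m : 9 ≤ n → 3 ≤ m
  9≤n⇒3≤m 9≤n = ≰⇒> λ m≤2 → <⇒≱ 9≤n (subst (_≤ 8) (sym n≡m*k) (*-mono-≤ m≤2 k≤4))

  large-cofactor : 9 ≤ n → LargeFactorPair n ⊎ SmallMultipleOfOddPrime n ⊎ n ∈ exceptions
  large-cofactor 9≤n with prime? m
  ... | yes m-prime = inj₂ (inj₁
        (k , 1≤k , k≤4 , m , m-prime , prime∧3≤⇒odd m-prime (9≤n⇒3≤m 9≤n) , trans n≡m*k (*-comm m k)))
  ... | no ¬m-prime with composite⇒product
        (¬prime⇒composite {{n>1⇒nonTrivial (≤-trans (s≤s (s≤s z≤n)) (9≤n⇒3≤m 9≤n))}} ¬m-prime)
  ...   | u , v , 2≤u , 2≤v , m≡uv = [ inj₁ , inj₂ ∘ inj₂ ]′ (composite-cofactor 2≤u 2≤v m≡uv)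

3≤n<9⇒exceptional⊎small-prime : ∀ {n} → n < 9 → 3 ≤ n → n ∈ exceptions ⊎ n ∈ (3 ∷ 5 ∷ 7 ∷ [])
3≤n<9⇒exceptional⊎small-prime = from-yes (allUpTo? (λ n → (3 ≤? n) →-dec ((n ∈? exceptions) ⊎-dec (n ∈? (3 ∷ 5 ∷ 7 ∷ [])))) 9)

∈[3,5,7]⇒smallMultiple : n ∈ (3 ∷ 5 ∷ 7 ∷ []) → SmallMultipleOfOddPrime n
∈[3,5,7]⇒smallMultiple (here refl)                 = 1 , ≤-refl , s≤s z≤n , 3 , from-yes (prime? 3) , refl , refl
∈[3,5,7]⇒smallMultiple (there (here refl))         = 1 , ≤-refl , s≤s z≤n , 5 , from-yes (prime? 5) , refl , refl
∈[3,5,7]⇒smallMultiple (there (there (here refl))) = 1 , ≤-refl , s≤s z≤n , 7 , from-yes (prime? 7) , refl , refl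

split-or-exceptional : 3 ≤ n → LargeFactorPair n ⊎ SmallMultipleOfOddPrime n ⊎ n ∈ exceptions
split-or-exceptional {n} 3≤n with n <? 9
... | yes n<9 = [ inj₂ ∘ inj₂ , inj₂ ∘ inj₁ ∘ ∈[3,5,7]⇒smallMultiple ]′ (3≤n<9⇒exceptional⊎small-prime n<9 3≤n)
... | no n≮9  = large-cofactor (largestSmallDivisor n) (≮⇒≥ n≮9)

subcritical⇒conditions : Subcritical n → ¬ SmallMultipleOfOddPrime n × n ∉ exceptions
subcritical⇒conditions (r , s , r≤s , refl , lt) with factorPair r≤s
... | short s<4 =
  n≤2⇒¬smallMultiple rs≤2 , outside⇒∉exceptions (inj₁ (s≤s (≤-trans rs≤2 (n≤1+n 2))))
  where
  rs≤2 : r * s ≤ 2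
  rs≤2 = short-subcritical (≤-<-trans r≤s s<4) s<4 r≤s lt
... | lopsided r≤4 4≤s = contradiction lt (<-asym (lopsided-bound r≤4 4≤s))
... | large a b 1≤a 1≤b =
    largeFactorPair⇒¬smallMultiple (4 + a , 4 + b , +-monoʳ-≤ 4 1≤a , +-monoʳ-≤ 4 1≤b , refl)
  , outside⇒∉exceptions (inj₂ (4<a*b⇒41≤[4+a]*[4+b] a b (Equivalence.to (shifted-subcritical⇔ a b) lt)))

large-pair⇒subcritical⊎exceptional : x ≤ y → 5 ≤ x → 5 ≤ y → Subcritical (x * y) ⊎ x * y ∈ exceptions
large-pair⇒subcritical⊎exceptional x≤y 5≤x 5≤y with factorPair x≤y
... | short y<4 = contradiction (≤-trans (n≤1+n 4) 5≤y) (<⇒≱ y<4)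
... | lopsided x≤4 _ = contradiction x≤4 (<⇒≱ 5≤x)
... | large a b 1≤a 1≤b with 4 <? a * b
...   | yes 4<ab = inj₁ (4 + a , 4 + b , x≤y , refl , Equivalence.from (shifted-subcritical⇔ a b) 4<ab)
...   | no 4≮ab = inj₂ (shifted-exceptional (s≤s (m*n≤o⇒m≤o 1≤b ab≤4)) (s≤s (m*n≤o⇒n≤o 1≤a ab≤4)) 1≤a 1≤b ab≤4)
  where
  ab≤4 : a * b ≤ 4
  ab≤4 = ≮⇒≥ 4≮ab

largeFactorPair⇒subcritical⊎exceptional : LargeFactorPair n → Subcritical n ⊎ n ∈ exceptions
largeFactorPair⇒subcritical⊎exceptional (x , y , 5≤x , 5≤y , refl) with ≤-total x y
... | inj₁ x≤y = large-pair⇒subcritical⊎exceptional x≤y 5≤x 5≤y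
... | inj₂ y≤x = subst (λ n → Subcritical n ⊎ n ∈ exceptions) (*-comm y x) (large-pair⇒subcritical⊎exceptional y≤x 5≤y 5≤x)

conditions⇒subcritical : ¬ SmallMultipleOfOddPrime n → n ∉ exceptions → Subcritical n
conditions⇒subcritical {0} _ _ = 0 , 0 , z≤n , refl , s≤s z≤n
conditions⇒subcritical {1} _ _ = 1 , 1 , ≤-refl , refl , m≤m+n 9 4
conditions⇒subcritical {2} _ _ = 1 , 2 , s≤s z≤n , refl , m≤m+n 13 1
conditions⇒subcritical {suc (suc (suc _))} ¬sm ∉ with split-or-exceptional (s≤s (s≤s (s≤s z≤n)))
... | inj₁ split = [ id , ⊥-elim ∘ ∉ ]′ (largeFactorPair⇒subcritical⊎exceptional split)
... | inj₂ (inj₁ sm) = contradiction sm ¬sm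
... | inj₂ (inj₂ n∈) = contradiction n∈ ∉

subcritical⇔conditions : Subcritical n ⇔ (¬ SmallMultipleOfOddPrime n × n ∉ exceptions)
subcritical⇔conditions = mk⇔ subcritical⇒conditions (uncurry conditions⇒subcritical)

critical⇒special : 0 < n → Critical n → n ∈ (4 ∷ 36 ∷ 40 ∷ [])
critical⇒special 0<rs (r , s , r≤s , refl , eq) with factorPair r≤s
... | short s<4 = short-critical (≤-<-trans r≤s s<4) s<4 0<rs eq
... | lopsided r≤4 4≤s = contradiction (lopsided-bound r≤4 4≤s) (<-irrefl (sym eq))
... | large a b 1≤a 1≤b = shifted-critical {a} (s≤s (m*n≤o⇒m≤o 1≤b ab≤4)) {b} (s≤s (m*n≤o⇒n≤o 1≤a ab≤4)) ab≡4
  where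
  ab≡4 : a * b ≡ 4
  ab≡4 = shifted-critical⇒ a b eq
  ab≤4 : a * b ≤ 4
  ab≤4 = ≤-reflexive ab≡4

exceptional⇒¬subcritical : n ∈ exceptions → ¬ Subcritical n
exceptional⇒¬subcritical n∈ sub = proj₂ (subcritical⇒conditions sub) n∈

special⇒critical∧¬subcritical : n ∈ (4 ∷ 36 ∷ 40 ∷ []) → Critical n × ¬ Subcritical n
special⇒critical∧¬subcritical (here refl) =
  (2 , 2 , ≤-refl , refl , refl) , exceptional⇒¬subcritical (from-yes (4 ∈? exceptions))
special⇒critical∧¬subcritical (there (here refl)) =
  (6 , 6 , ≤-refl , refl , refl) , exceptional⇒¬subcritical (from-yes (36 ∈? exceptions))
special⇒critical∧¬subcritical (there (there (here refl))) =
  (5 , 8 , m≤m+n 5 3 , refl , refl) , exceptional⇒¬subcritical (from-yes (40 ∈? exceptions))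

critical∧¬subcritical⇔special : 0 < n → (Critical n × ¬ Subcritical n) ⇔ n ∈ (4 ∷ 36 ∷ 40 ∷ [])
critical∧¬subcritical⇔special 0<n = mk⇔ (critical⇒special 0<n ∘ proj₁) special⇒critical∧¬subcritical

proposition4p1 : ∀ (n d : ℕ) → 0 < n → IsDelta n d →
    ((4 * d < n + 12) ⇔
      ((¬ IsMulOddPrime 1 n × ¬ IsMulOddPrime 2 n × ¬ IsMulOddPrime 3 n × ¬ IsMulOddPrime 4 n)
        × n ∉ (4 ∷ 6 ∷ 8 ∷ 16 ∷ 18 ∷ 24 ∷ 25 ∷ 27 ∷ 30 ∷ 32 ∷ 35 ∷ 36 ∷ 40 ∷ [])))
    × ((4 * d ≡ n + 12) ⇔ n ∈ (4 ∷ 36 ∷ 40 ∷ []))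
proposition4p1 n d 0<n isδ =
    ⇔-trans (isDelta⇒<⇔subcritical isδ) (⇔-trans subcritical⇔conditions (¬smallMultiple⇔ ×-⇔ ⇔-refl))
  , ⇔-trans (isDelta⇒≡⇔critical isδ) (critical∧¬subcritical⇔special 0<n)
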